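{- Let $F$ be a field with additive group $F^+$, let $S \subset F\setminus\{0\}$ with $-1\in S$ and $S$ closed under multiplication, let $X=\operatorname{Cay}(F^+;S)$, and let $K$ be a proper subfield of $F$ with $[F:K]<\infty$ such that $K$ forms a clique in $X$. Let $V$ be a $K$-subspace of $F$ with $K\subset V$ such that $V$ is a clique in $X$. If $V$ is not a maximal clique in $X$, then there is $g \in F \setminus V$ such that $V \oplus gK$ is a clique in $X$.
   Context: For an abelian group $G$ and $S\subset G$ with $S=-S$, the Cayley graph $\operatorname{Cay}(G;S)$ has vertex set $G$, with $g,h$ adjacent iff $g-h\in S$. A clique is a set of pairwise adjacent vertices; it is maximal if no further vertex can be added while remaining a clique. -}

module Defs where

open import Level using (Level; _⊔_; suc)
open import Algebra.Bundles using (CommutativeRing)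
open import Data.Nat using (ℕ; zero) renaming (suc to sucℕ)
open import Data.Fin using (Fin) renaming (zero to fzero; suc to fsuc)
open import Data.Product using (Σ; Σ-syntax; ∃; _×_; _,_)
open import Data.Sum using (_⊎_)
open import Relation.Nullary using (¬_)

record Field (c ℓ : Level) : Set (suc (c ⊔ ℓ)) where
  field
    commutativeRing : CommutativeRing c ℓ
  open CommutativeRing commutativeRing public
  field
    0≉1     : ¬ (0# ≈ 1#)
    inverse : ∀ x → ¬ (x ≈ 0#) → Σ[ y ∈ Carrier ] (x * y ≈ 1#)

module _ {c ℓ : Level} (F : Field c ℓ) where
  open Field F

  -- subsets of F are predicates, required to respect the setoid equality
  Respects≈ : ∀ {p} → (Carrier → Set p) → Set (c ⊔ ℓ ⊔ p)
  Respects≈ P = ∀ {x y} → x ≈ y → P x → P y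

  ∑ : (n : ℕ) → (Fin n → Carrier) → Carrier
  ∑ zero    f = 0#
  ∑ (sucℕ n) f = f fzero + ∑ n (λ i → f (fsuc i))

  -- Cay(F⁺; S): g, h adjacent iff g - h ∈ S
  Adjacent : ∀ {p} → (Carrier → Set p) → Carrier → Carrier → Set p
  Adjacent S g h = S (g - h)

  IsClique : ∀ {p q} → (Carrier → Set p) → (Carrier → Set q) → Set (c ⊔ ℓ ⊔ p ⊔ q)
  IsClique S C = ∀ {x y} → C x → C y → ¬ (x ≈ y) → Adjacent S x y

  insert : ∀ {q} → (Carrier → Set q) → Carrier → Carrier → Set (ℓ ⊔ q)
  insert C z x = C x ⊎ (x ≈ z)

  IsMaximalClique : ∀ {p q} → (Carrier → Set p) → (Carrier → Set q) → Set (c ⊔ ℓ ⊔ p ⊔ q)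
  IsMaximalClique S C = IsClique S C × (∀ z → ¬ C z → ¬ IsClique S (insert C z))

  IsConnectionSet : ∀ {p} → (Carrier → Set p) → Set (c ⊔ ℓ ⊔ p)
  IsConnectionSet S =
    Respects≈ S × (∀ x → S x → ¬ (x ≈ 0#)) × S (- 1#) × (∀ x y → S x → S y → S (x * y))

  IsSubfield : ∀ {p} → (Carrier → Set p) → Set (c ⊔ ℓ ⊔ p)
  IsSubfield K =
    Respects≈ K × K 0# × K 1#
    × (∀ x y → K x → K y → K (x + y))
    × (∀ x → K x → K (- x))
    × (∀ x y → K x → K y → K (x * y))
    × (∀ x → K x → ¬ (x ≈ 0#) → Σ[ y ∈ Carrier ] (K y × x * y ≈ 1#))

  IsProper : ∀ {p} → (Carrier → Set p) → Set (c ⊔ p)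
  IsProper K = Σ[ x ∈ Carrier ] ¬ K x

  -- [F : K] < ∞ : F is spanned over K by finitely many elements
  FiniteDegree : ∀ {p} → (Carrier → Set p) → Set (c ⊔ ℓ ⊔ p)
  FiniteDegree K =
    Σ[ n ∈ ℕ ] Σ[ b ∈ (Fin n → Carrier) ]
      (∀ x → Σ[ a ∈ (Fin n → Carrier) ] ((∀ i → K (a i)) × x ≈ ∑ n (λ i → a i * b i)))

  IsSubspace : ∀ {p q} → (Carrier → Set p) → (Carrier → Set q) → Set (c ⊔ ℓ ⊔ p ⊔ q)
  IsSubspace K V =
    Respects≈ V × V 0#
    × (∀ x y → V x → V y → V (x + y))
    × (∀ k x → K k → V x → V (k * x))

  _⊕_·_ : ∀ {p q} → (Carrier → Set q) → Carrier → (Carrier → Set p) → Carrier → Set (c ⊔ ℓ ⊔ p ⊔ q)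
  (V ⊕ g · K) x = Σ[ v ∈ Carrier ] Σ[ k ∈ Carrier ] (V v × K k × x ≈ v + g * k)

-- As V is not maximal, excluded middle yields a vertex z ∉ V adjacent to every
-- vertex of V; take g = z.  Two points v + zk and v' + zk' of V ⊕ zK with k ≠ k'
-- differ by (z - w)(k - k') where w = -(k - k')⁻¹(v - v') ∈ V.  Here z - w ∈ S
-- since z is adjacent to w, and k - k' ∈ S since K is a clique, so the
-- difference lies in S as S is closed under multiplication.  If k = k', the
-- difference is v - v' ∈ S.
module Submission where

open import Defs
open import Level using (_⊔_; Lift; lift; lower)
open import Algebra.Bundles using (CommutativeRing)
open import Axiom.ExcludedMiddle using (ExcludedMiddle)
open import Data.Product using (Σ; Σ-syntax; _×_; _,_)
open import Data.Sum using (inj₁; inj₂)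
open import Relation.Binary.Definitions using (Decidable)
open import Relation.Nullary using (¬_; Dec; yes; no)
open import Relation.Nullary.Decidable using (map′; decidable-stable)
import Algebra.Properties.AbelianGroup as AbelianGroupProperties
import Algebra.Properties.CommutativeSemigroup as CommutativeSemigroupProperties
import Algebra.Properties.Group as GroupProperties
import Algebra.Properties.Ring as RingProperties
import Relation.Binary.Reasoning.Setoid as SetoidReasoning

lower-excludedMiddle : ∀ {a} b → ExcludedMiddle (a ⊔ b) → ExcludedMiddle a
lower-excludedMiddle b em {P} = map′ lower lift (em {Lift b P})

module _ {c ℓ} (R : CommutativeRing c ℓ) where
  open CommutativeRing R
  open SetoidReasoning setoid
  open AbelianGroupProperties +-abelianGroup using (⁻¹-∙-comm)
  open CommutativeSemigroupProperties +-commutativeSemigroup using (interchange)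
  open RingProperties ring using (x[y-z]≈xy-xz)

  [a+b]-[c+d]≈[a-c]+[b-d] : ∀ a b c d → (a + b) - (c + d) ≈ (a - c) + (b - d)
  [a+b]-[c+d]≈[a-c]+[b-d] a b c d = begin
    (a + b) - (c + d)     ≈⟨ +-congˡ (⁻¹-∙-comm c d) ⟨
    (a + b) + (- c + - d) ≈⟨ interchange a b (- c) (- d) ⟩
    (a - c) + (b - d)     ∎

  [u+zk]-[v+zl]≈[u-v]+z[k-l] : ∀ u v z k l → (u + z * k) - (v + z * l) ≈ (u - v) + z * (k - l)
  [u+zk]-[v+zl]≈[u-v]+z[k-l] u v z k l = begin
    (u + z * k) - (v + z * l) ≈⟨ [a+b]-[c+d]≈[a-c]+[b-d] u (z * k) v (z * l) ⟩
    (u - v) + (z * k - z * l) ≈⟨ +-congˡ (x[y-z]≈xy-xz z k l) ⟨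
    (u - v) + z * (k - l)     ∎

  [z+iu]d≈zd+u : ∀ {d i} → d * i ≈ 1# → ∀ z u → (z + i * u) * d ≈ z * d + u
  [z+iu]d≈zd+u {d} {i} di≈1 z u = begin
    (z + i * u) * d     ≈⟨ distribʳ d z (i * u) ⟩
    z * d + (i * u) * d ≈⟨ +-congˡ (*-comm (i * u) d) ⟩
    z * d + d * (i * u) ≈⟨ +-congˡ (*-assoc d i u) ⟨
    z * d + (d * i) * u ≈⟨ +-congˡ (*-congʳ di≈1) ⟩
    z * d + 1# * u      ≈⟨ +-congˡ (*-identityˡ u) ⟩
    z * d + u           ∎

module _ {c ℓ} (F : Field c ℓ) where
  open Field F
  open SetoidReasoning setoid
  open GroupProperties +-group using (⁻¹-involutive; x≈y⇒x∙y⁻¹≈ε)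
  open RingProperties ring using (-1*x≈-x)

  decidable-≈ : ExcludedMiddle ℓ → Decidable _≈_
  decidable-≈ em x y = em

  subfield-sub : ∀ {p} {K : Carrier → Set p} → IsSubfield F K →
    ∀ {x y} → K x → K y → K (x - y)
  subfield-sub (_ , _ , _ , K-+ , K-neg , _) {x} {y} Kx Ky = K-+ x (- y) Kx (K-neg y Ky)

  module _ {p q} {K : Carrier → Set p} {V : Carrier → Set q} where

    subspace-neg : IsSubfield F K → IsSubspace F K V → ∀ {x} → V x → V (- x)
    subspace-neg (_ , _ , K1 , _ , K-neg , _) (V-resp , _ , _ , V-*) {x} Vx =
      V-resp (-1*x≈-x x) (V-* (- 1#) x (K-neg 1# K1) Vx)

    subspace-sub : IsSubfield F K → IsSubspace F K V → ∀ {x y} → V x → V y → V (x - y)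
    subspace-sub K-subfield V-subspace@(_ , _ , V-+ , _) {x} {y} Vx Vy =
      V-+ x (- y) Vx (subspace-neg K-subfield V-subspace Vy)

  insert-clique⇒adjacent : ∀ {p q} {S : Carrier → Set p} {C : Carrier → Set q} {z} →
    Respects≈ F C → ¬ C z → IsClique F S (insert F C z) → ∀ {w} → C w → Adjacent F S z w
  insert-clique⇒adjacent C-resp ¬Cz clique Cw =
    clique (inj₂ refl) (inj₁ Cw) (λ z≈w → ¬Cz (C-resp (sym z≈w) Cw))

  ¬maximal⇒extendable : ∀ {p q} {S : Carrier → Set p} {C : Carrier → Set q} →
    ExcludedMiddle (c ⊔ ℓ ⊔ p ⊔ q) → IsClique F S C → ¬ IsMaximalClique F S C →
    Σ[ z ∈ Carrier ] (¬ C z × IsClique F S (insert F C z))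
  ¬maximal⇒extendable {S = S} {C} em clique ¬maximal =
    decidable-stable (em {Σ[ z ∈ Carrier ] (¬ C z × IsClique F S (insert F C z))}) λ ¬extendable →
    ¬maximal (clique , λ z ¬Cz z-clique → ¬extendable (z , ¬Cz , z-clique))

  module _ {p} {S K V : Carrier → Set p} {z : Carrier} where

    equal-coefficients-adjacent : Respects≈ F S → IsClique F S V →
      ∀ {v v' k k'} → V v → V v' → k ≈ k' → ¬ v + z * k ≈ v' + z * k' →
      S ((v + z * k) - (v' + z * k'))
    equal-coefficients-adjacent S-resp V-clique {v} {v'} {k} {k'} Vv Vv' k≈k' x≉y =
      S-resp (sym difference) (V-clique Vv Vv' λ v≈v' → x≉y (+-cong v≈v' (*-congˡ k≈k')))
      where
      difference : (v + z * k) - (v' + z * k') ≈ v - v'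
      difference = begin
        (v + z * k) - (v' + z * k') ≈⟨ [u+zk]-[v+zl]≈[u-v]+z[k-l] commutativeRing v v' z k k' ⟩
        (v - v') + z * (k - k')     ≈⟨ +-congˡ (*-congˡ (x≈y⇒x∙y⁻¹≈ε k≈k')) ⟩
        (v - v') + z * 0#           ≈⟨ +-congˡ (zeroʳ z) ⟩
        (v - v') + 0#               ≈⟨ +-identityʳ (v - v') ⟩
        v - v'                      ∎

    distinct-coefficients-adjacent : IsConnectionSet F S → IsSubfield F K → IsClique F S K →
      IsSubspace F K V → (∀ {w} → V w → Adjacent F S z w) →
      ∀ {v v' k k'} → V v → V v' → K k → K k' → ¬ k ≈ k' →
      S ((v + z * k) - (v' + z * k'))
    distinct-coefficients-adjacent (S-resp , S≉0 , _ , S-*)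
      K-subfield@(_ , _ , _ , _ , _ , _ , K-inverse) K-clique V-subspace@(_ , _ , _ , V-*)
      z-adjacent {v} {v'} {k} {k'} Vv Vv' Kk Kk' k≉k'
      with Sd ← K-clique Kk Kk' k≉k'
      with (i , Ki , di≈1) ← K-inverse (k - k') (subfield-sub K-subfield Kk Kk') (S≉0 (k - k') Sd)
      = S-resp (sym difference) (S-* (z - w) (k - k') (z-adjacent Vw) Sd)
      where
      u w : Carrier
      u = v - v'
      w = - (i * u)
      Vw : V w
      Vw = subspace-neg K-subfield V-subspace (V-* i u Ki (subspace-sub K-subfield V-subspace Vv Vv'))
      difference : (v + z * k) - (v' + z * k') ≈ (z - w) * (k - k')
      difference = begin
        (v + z * k) - (v' + z * k') ≈⟨ [u+zk]-[v+zl]≈[u-v]+z[k-l] commutativeRing v v' z k k' ⟩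
        u + z * (k - k')            ≈⟨ +-comm u _ ⟩
        z * (k - k') + u            ≈⟨ [z+iu]d≈zd+u commutativeRing di≈1 z u ⟨
        (z + i * u) * (k - k')      ≈⟨ *-congʳ (+-congˡ (⁻¹-involutive (i * u))) ⟨
        (z - w) * (k - k')          ∎

    extension-clique : Decidable _≈_ → IsConnectionSet F S → IsSubfield F K → IsClique F S K →
      IsSubspace F K V → IsClique F S V → (∀ {w} → V w → Adjacent F S z w) →
      IsClique F S (_⊕_·_ F V z K)
    extension-clique _≟_ S-connection@(S-resp , _) K-subfield K-clique V-subspace V-clique
      z-adjacent (v , k , Vv , Kk , x≈) (v' , k' , Vv' , Kk' , y≈) x≉y =
      S-resp (sym (+-cong x≈ (-‿cong y≈))) (canonical-adjacent (k ≟ k'))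
      where
      canonical-adjacent : Dec (k ≈ k') → S ((v + z * k) - (v' + z * k'))
      canonical-adjacent (yes k≈k') = equal-coefficients-adjacent S-resp V-clique Vv Vv' k≈k'
        λ e → x≉y (trans x≈ (trans e (sym y≈)))
      canonical-adjacent (no k≉k') = distinct-coefficients-adjacent S-connection K-subfield
        K-clique V-subspace z-adjacent Vv Vv' Kk Kk' k≉k'

lemma2p3 : ∀ {c ℓ p} → ExcludedMiddle (c ⊔ ℓ ⊔ p) →
    (F : Field c ℓ) → (S K V : Field.Carrier F → Set p) →
    IsConnectionSet F S →
    IsSubfield F K → IsProper F K → FiniteDegree F K → IsClique F S K →
    IsSubspace F K V → (∀ x → K x → V x) → IsClique F S V →
    ¬ IsMaximalClique F S V →
    Σ[ g ∈ Field.Carrier F ] (¬ V g × IsClique F S (_⊕_·_ F V g K))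
lemma2p3 {c} {ℓ} {p} em F S K V S-connection K-subfield _ _ K-clique V-subspace@(V-resp , _) _
  V-clique ¬maximal
  with z , ¬Vz , z-clique ← ¬maximal⇒extendable F {S = S} {V} em V-clique ¬maximal
  = z , ¬Vz , extension-clique F {S = S} {K} {V} _≟_ S-connection K-subfield K-clique
      V-subspace V-clique (insert-clique⇒adjacent F {S = S} {V} V-resp ¬Vz z-clique)
  where
  _≟_ : Decidable (Field._≈_ F)
  _≟_ = decidable-≈ F (lower-excludedMiddle (c ⊔ p) em)
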